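{- Let $\mathscr{L}$ be a language with semantic structure $\mathcal{S}=(\Sigma,I)$. For every abstract domain $A \in \mathrm{Abs}(\wp(\Sigma))$: $A$ is strongly preserving for $\mathscr{L}$ if and only if $A \sqsubseteq \mathrm{AD}_{\mathscr{L}}$, where $\mathrm{AD}_{\mathscr{L}} := \mathcal{M}(\{[\![\varphi]\!]_{\mathcal{S}} \mid \varphi\in\mathscr{L}\})$.
   Context: A language $\mathscr{L}$: formulas $\varphi ::= p \mid f(\varphi_1,\dots,\varphi_n)$ with $p\in AP$, $f\in Op$ finite, arities $>0$; a semantic structure $(\Sigma,I)$ interprets $p$ as $I(p)\subseteq\Sigma$ and $f$ as $I(f):\wp(\Sigma)^{n}\to\wp(\Sigma)$, giving the concrete semantics $[\![\cdot]\!]_{\mathcal{S}}:\mathscr{L}\to\wp(\Sigma)$ inductively. $\mathrm{Abs}(\wp(\Sigma))$: abstract domains $A$ given by Galois insertions $(\alpha,\wp(\Sigma),A,\gamma)$ ($\alpha(S)\le a\iff S\subseteq\gamma(a)$, $\alpha\circ\gamma=\mathrm{id}$), identified by their closure $\mu_A=\gamma\circ\alpha$, ordered by $A_1\sqsubseteq A_2$ iff $\mu_{A_1}\subseteq\mu_{A_2}$ pointwise; equivalently, closures are identified with their images (subsets of $\wp(\Sigma)$ closed under arbitrary intersections, including $\Sigma$), and $A_1\sqsubseteq A_2$ iff $\mathrm{img}(\mu_{A_2})\subseteq\mathrm{img}(\mu_{A_1})$. $\mathcal{M}(X)$ is the Moore closure of $X\subseteq\wp(\Sigma)$: the set of all intersections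 of subfamilies of $X$ (the empty intersection being $\Sigma$). The best correct abstract semantics $[\![\cdot]\!]^A_{\mathcal{S}}:\mathscr{L}\to A$ is defined by $[\![p]\!]^A_{\mathcal{S}}=\alpha(I(p))$, $[\![f(\vec\varphi)]\!]^A_{\mathcal{S}}=\alpha(I(f)(\gamma([\![\varphi_1]\!]^A_{\mathcal{S}}),\dots,\gamma([\![\varphi_n]\!]^A_{\mathcal{S}})))$. $A$ is strongly preserving for $\mathscr{L}$ if for all $\varphi\in\mathscr{L}$ and $S\subseteq\Sigma$: $\alpha(S)\le_A[\![\varphi]\!]^A_{\mathcal{S}}\iff S\subseteq[\![\varphi]\!]_{\mathcal{S}}$. -}

module Defs where

open import Level using (Level; 0ℓ; _⊔_) renaming (suc to lsuc)
open import Data.Nat using (ℕ; _<_)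
open import Data.Fin using (Fin)
open import Data.Product using (_×_; ∃; _,_)
open import Relation.Unary using (Pred; _⊆_; _∈_)
open import Relation.Binary.Bundles using (Poset)
open import Relation.Binary.PropositionalEquality using (_≡_)

℘ : Set → Set₁
℘ St = Pred St 0ℓ

_≐_ : {St : Set} → ℘ St → ℘ St → Set
X ≐ Y = (X ⊆ Y) × (Y ⊆ X)

⋂ : {St : Set} {J : Set} → (J → ℘ St) → ℘ St
⋂ t s = ∀ j → t j s

Moore : {St : Set} {ℓ : Level} → Pred (℘ St) ℓ → Pred (℘ St) (lsuc 0ℓ ⊔ ℓ)
Moore {St} X S =
  ∃ λ (J : Set) → ∃ λ (t : J → ℘ St) → ((j : J) → X (t j)) × (S ≐ ⋂ t)

record Language : Set₁ where
  field
    AP        : Set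
    #Op       : ℕ
    arity     : Fin #Op → ℕ
    arity-pos : (f : Fin #Op) → 0 < arity f
  Op : Set
  Op = Fin #Op

data Formula (L : Language) : Set where
  atom : Language.AP L → Formula L
  app  : (f : Language.Op L) → (Fin (Language.arity L f) → Formula L) → Formula L

record SemStr (L : Language) : Set₁ where
  open Language L
  field
    State : Set
    Iap   : AP → ℘ State
    Iop   : (f : Op) → (Fin (arity f) → ℘ State) → ℘ State
    -- I(f) is a function on sets, i.e. respects extensional set equality
    Iop-ext : (f : Op) (Xs Ys : Fin (arity f) → ℘ State) →
              ((i : Fin (arity f)) → Xs i ≐ Ys i) → Iop f Xs ≐ Iop f Ys

module _ {L : Language} (𝒮 : SemStr L) where
  open SemStr 𝒮

  ⟦_⟧ : Formula L → ℘ State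
  ⟦ atom p ⟧   = Iap p
  ⟦ app f φs ⟧ = Iop f (λ i → ⟦ φs i ⟧)

  AD : Pred (℘ State) (lsuc 0ℓ)
  AD = Moore (λ S → ∃ λ (φ : Formula L) → S ≡ ⟦ φ ⟧)

record AbsDomain (St : Set) (a ℓ₁ ℓ₂ : Level) : Set (lsuc (a ⊔ ℓ₁ ⊔ ℓ₂)) where
  field
    A : Poset a ℓ₁ ℓ₂
  open Poset A public
  field
    α : ℘ St → Carrier
    γ : Carrier → ℘ St
    galois    : (S : ℘ St) (x : Carrier) → (α S ≤ x → S ⊆ γ x) × (S ⊆ γ x → α S ≤ x)
    insertion : (x : Carrier) → α (γ x) ≈ x

  μ : ℘ St → ℘ St
  μ S = γ (α S)

  img : Pred (℘ St) (lsuc 0ℓ)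
  img S = ∃ λ (T : ℘ St) → μ T ≐ S

-- A ⊑ B (B given by its image, a Moore family) iff img(μ_B) ⊆ img(μ_A)
_⊑_ : {St : Set} {a ℓ₁ ℓ₂ ℓ : Level} → AbsDomain St a ℓ₁ ℓ₂ → Pred (℘ St) ℓ → Set _
_⊑_ {St} D B = (S : ℘ St) → B S → AbsDomain.img D S

module _ {L : Language} (𝒮 : SemStr L) {a ℓ₁ ℓ₂ : Level}
         (D : AbsDomain (SemStr.State 𝒮) a ℓ₁ ℓ₂) where
  open SemStr 𝒮
  open AbsDomain D

  ⟦_⟧^A : Formula L → Carrier
  ⟦ atom p ⟧^A   = α (Iap p)
  ⟦ app f φs ⟧^A = α (Iop f (λ i → γ ⟦ φs i ⟧^A))

  StronglyPreserving : Set _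
  StronglyPreserving = (φ : Formula L) (S : ℘ State) →
    (α S ≤ ⟦ φ ⟧^A → S ⊆ ⟦ 𝒮 ⟧ φ) × (S ⊆ ⟦ 𝒮 ⟧ φ → α S ≤ ⟦ φ ⟧^A)

{-# OPTIONS --safe #-}
-- The μ-closed sets of a Galois insertion form a Moore family, so D ⊑ M(X) holds iff
-- every member of X is μ-closed. Strong preservation of φ says that the S with
-- α S ≤ ⟦φ⟧^A are exactly the subsets of ⟦φ⟧, i.e. γ ⟦φ⟧^A = ⟦φ⟧. Such a γ-image is
-- μ-closed; conversely, if every ⟦φ⟧ is μ-closed then γ ⟦φ⟧^A = μ ⟦φ⟧ = ⟦φ⟧ by
-- induction on φ.
module Submission where

open import Defs
open import Level using (Level)
open import Data.Product using (_×_; _,_; proj₁; proj₂; ∃)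
open import Data.Unit using (⊤; tt)
open import Function using (id; _∘_; _⇔_; mk⇔; Equivalence)
open import Function.Related.Propositional using (module EquationalReasoning)
open import Relation.Binary.PropositionalEquality as ≡ using (_≡_)
open import Relation.Unary using (_⊆_)
open import Relation.Unary.Properties using (≐-sym; ≐-trans)

module GaloisInsertion {St : Set} {a ℓ₁ ℓ₂ : Level} (D : AbsDomain St a ℓ₁ ℓ₂) where
  open AbsDomain D

  μ-extensive : (S : ℘ St) → S ⊆ μ S
  μ-extensive S = proj₁ (galois S (α S)) refl

  αγ≤ : (x : Carrier) → α (γ x) ≤ x
  αγ≤ x = proj₂ (galois (γ x) x) id

  γ-mono : {x y : Carrier} → x ≤ y → γ x ⊆ γ y
  γ-mono {x} {y} x≤y = proj₁ (galois (γ x) y) (trans (αγ≤ x) x≤y)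

  α-mono : {S T : ℘ St} → S ⊆ T → α S ≤ α T
  α-mono {S} {T} S⊆T = proj₂ (galois S (α T)) (μ-extensive T ∘ S⊆T)

  μ-mono : {S T : ℘ St} → S ⊆ T → μ S ⊆ μ T
  μ-mono = γ-mono ∘ α-mono

  μ-cong : {S T : ℘ St} → S ≐ T → μ S ≐ μ T
  μ-cong (S⊆T , T⊆S) = μ-mono S⊆T , μ-mono T⊆S

  Closed : ℘ St → Set
  Closed S = μ S ⊆ S

  Closed⇒μ≐ : {S : ℘ St} → Closed S → μ S ≐ S
  Closed⇒μ≐ {S} μS⊆S = μS⊆S , μ-extensive S

  Closed-resp-≐ : {S T : ℘ St} → S ≐ T → Closed S → Closed T
  Closed-resp-≐ (S⊆T , T⊆S) μS⊆S = S⊆T ∘ μS⊆S ∘ μ-mono T⊆S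

  γ-Closed : (x : Carrier) → Closed (γ x)
  γ-Closed x = γ-mono (αγ≤ x)

  Closed-⋂ : {J : Set} {t : J → ℘ St} → (∀ j → Closed (t j)) → Closed (⋂ t)
  Closed-⋂ closed s∈μ⋂ j = closed j (μ-mono (λ s∈⋂ → s∈⋂ j) s∈μ⋂)

  img⇔Closed : {S : ℘ St} → img S ⇔ Closed S
  img⇔Closed {S} = mk⇔ img⇒Closed (λ μS⊆S → S , Closed⇒μ≐ μS⊆S)
    where
    img⇒Closed : img S → Closed S
    img⇒Closed (T , μT≐S) = Closed-resp-≐ μT≐S (γ-Closed (α T))

  all-Closed⇔⊑-Moore-range : {I : Set} (F : I → ℘ St) →
    (∀ i → Closed (F i)) ⇔ D ⊑ Moore (λ S → ∃ λ i → S ≡ F i)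
  all-Closed⇔⊑-Moore-range F = mk⇔ all-Closed⇒⊑ ⊑⇒all-Closed
    where
    all-Closed⇒⊑ : (∀ i → Closed (F i)) → D ⊑ Moore (λ S → ∃ λ i → S ≡ F i)
    all-Closed⇒⊑ closed S (J , t , t∈range , S≐⋂t) =
      Equivalence.from img⇔Closed (Closed-resp-≐ (≐-sym S≐⋂t) (Closed-⋂ t-Closed))
      where
      t-Closed : ∀ j → Closed (t j)
      t-Closed j with t∈range j
      ... | i , tj≡Fi = ≡.subst Closed (≡.sym tj≡Fi) (closed i)

    ⊑⇒all-Closed : D ⊑ Moore (λ S → ∃ λ i → S ≡ F i) → ∀ i → Closed (F i)
    ⊑⇒all-Closed sub i = Equivalence.to img⇔Closed (sub (F i) F-i∈Moore)
      where
      F-i∈Moore : Moore (λ S → ∃ λ i → S ≡ F i) (F i)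
      F-i∈Moore = ⊤ , (λ _ → F i) , (λ _ → i , ≡.refl) ,
                  (λ s∈F-i _ → s∈F-i) , (λ s∈⋂ → s∈⋂ tt)

  -- StronglyPreserving 𝒮 D is ∀ φ → Represents (⟦ φ ⟧^A) (⟦ 𝒮 ⟧ φ).
  Represents : Carrier → ℘ St → Set _
  Represents x T = (S : ℘ St) → (α S ≤ x → S ⊆ T) × (S ⊆ T → α S ≤ x)

  Represents⇔γ≐ : {x : Carrier} {T : ℘ St} → Represents x T ⇔ γ x ≐ T
  Represents⇔γ≐ {x} {T} = mk⇔ Represents⇒γ≐ γ≐⇒Represents
    where
    Represents⇒γ≐ : Represents x T → γ x ≐ T
    Represents⇒γ≐ rep = proj₁ (rep (γ x)) (αγ≤ x) , proj₁ (galois T x) (proj₂ (rep T) id)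

    γ≐⇒Represents : γ x ≐ T → Represents x T
    γ≐⇒Represents (γx⊆T , T⊆γx) S =
      (λ αS≤x → γx⊆T ∘ proj₁ (galois S x) αS≤x) ,
      (λ S⊆T → proj₂ (galois S x) (T⊆γx ∘ S⊆T))

module Semantics {L : Language} (𝒮 : SemStr L) {a ℓ₁ ℓ₂ : Level}
                 (D : AbsDomain (SemStr.State 𝒮) a ℓ₁ ℓ₂) where
  open SemStr 𝒮
  open AbsDomain D using (γ)
  open GaloisInsertion D

  StronglyPreserving⇔γ⟦⟧^A≐⟦⟧ :
    StronglyPreserving 𝒮 D ⇔ (∀ φ → γ (⟦_⟧^A 𝒮 D φ) ≐ ⟦ 𝒮 ⟧ φ)
  StronglyPreserving⇔γ⟦⟧^A≐⟦⟧ = mk⇔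
    (λ sp φ → Equivalence.to Represents⇔γ≐ (sp φ))
    (λ γ≐ φ → Equivalence.from Represents⇔γ≐ (γ≐ φ))

  all-Closed⇒γ⟦⟧^A≐⟦⟧ : (∀ φ → Closed (⟦ 𝒮 ⟧ φ)) → ∀ φ → γ (⟦_⟧^A 𝒮 D φ) ≐ ⟦ 𝒮 ⟧ φ
  all-Closed⇒γ⟦⟧^A≐⟦⟧ closed (atom p)   = Closed⇒μ≐ (closed (atom p))
  all-Closed⇒γ⟦⟧^A≐⟦⟧ closed (app f φs) =
    ≐-trans (μ-cong (Iop-ext f _ _ (all-Closed⇒γ⟦⟧^A≐⟦⟧ closed ∘ φs)))
            (Closed⇒μ≐ (closed (app f φs)))

  γ⟦⟧^A≐⟦⟧⇔all-Closed : (∀ φ → γ (⟦_⟧^A 𝒮 D φ) ≐ ⟦ 𝒮 ⟧ φ) ⇔ (∀ φ → Closed (⟦ 𝒮 ⟧ φ))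
  γ⟦⟧^A≐⟦⟧⇔all-Closed = mk⇔ γ≐⇒Closed all-Closed⇒γ⟦⟧^A≐⟦⟧
    where
    γ≐⇒Closed : (∀ φ → γ (⟦_⟧^A 𝒮 D φ) ≐ ⟦ 𝒮 ⟧ φ) → ∀ φ → Closed (⟦ 𝒮 ⟧ φ)
    γ≐⇒Closed γ≐ φ = Closed-resp-≐ (γ≐ φ) (γ-Closed (⟦_⟧^A 𝒮 D φ))

theorem5p8 : {L : Language} (𝒮 : SemStr L) {a ℓ₁ ℓ₂ : Level}
             (D : AbsDomain (SemStr.State 𝒮) a ℓ₁ ℓ₂) →
             (StronglyPreserving 𝒮 D → D ⊑ AD 𝒮) × (D ⊑ AD 𝒮 → StronglyPreserving 𝒮 D)
theorem5p8 𝒮 D = Equivalence.to StronglyPreserving⇔⊑AD , Equivalence.from StronglyPreserving⇔⊑AD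
  where
  open AbsDomain D using (γ)
  open GaloisInsertion D using (Closed; all-Closed⇔⊑-Moore-range)
  open Semantics 𝒮 D

  StronglyPreserving⇔⊑AD : StronglyPreserving 𝒮 D ⇔ D ⊑ AD 𝒮
  StronglyPreserving⇔⊑AD = begin
    StronglyPreserving 𝒮 D              ∼⟨ StronglyPreserving⇔γ⟦⟧^A≐⟦⟧ ⟩
    (∀ φ → γ (⟦_⟧^A 𝒮 D φ) ≐ ⟦ 𝒮 ⟧ φ)   ∼⟨ γ⟦⟧^A≐⟦⟧⇔all-Closed ⟩
    (∀ φ → Closed (⟦ 𝒮 ⟧ φ))            ∼⟨ all-Closed⇔⊑-Moore-range (⟦_⟧ 𝒮) ⟩
    D ⊑ AD 𝒮                            ∎
    where open EquationalReasoning
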